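{- Let $n\geq 2$ and let ${\cal A}$ be an arc in $R^n$. Then (i) $\rho_i({\cal A})$ is an $|{\cal A}|$-arc in $R_i^n$, and $\pi_i(\rho_i({\cal A}))$ is an $|{\cal A}|$-arc in $(R_i/M_i)^n$, for all $i\in[\ell]$; (ii) ${\cal A}$ is complete if and only if there exists some $i_0\in[\ell]$ such that $\pi_{i_0}(\rho_{i_0}({\cal A}))$ is complete.
   Context: $R$ is a finite commutative ring with identity $1\neq0$, written as $R=R_1\times\cdots\times R_\ell$ with $R_i$ finite local rings with maximal ideals $M_i$; $\rho_i:R\to R_i$ is the projection and $\pi_i:R_i\to R_i/M_i$ the natural map, both applied entrywise to vectors. For a commutative ring $S$ (here $R$, $R_i$ or the field $R_i/M_i$), a set of vectors in $S^n$ is unimodular if the matrix having them as rows has a right inverse; an $m$-subspace of $S^n$ is a submodule with a basis of $m$ vectors forming a unimodular set. Points of $S^n$ are $1$-subspaces $\langle\alpha\rangle$. A $k$-arc in $S^n$ is a set of $k$ points such that any $n$ of them span the whole space $S^n$; arcs are assumed to have size at least $n+1$. An arc is complete if it is not contained in a larger arc. For a set ${\cal S}$ of points of $R^n$, $\rho_i({\cal S})=\{\langle\rho_i(\alpha)\rangle:\langle\alpha\rangle\in{\cal S}\}$ and $\pi_i(\rho_i({\cal S}))=\{\langle\pi_i(\rho_i(\alpha))\rangle:\langle\alpha\rangle\in{\cal S}\}$. -}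

module Defs where

open import Level using (Level; _⊔_) renaming (suc to lsuc)
open import Data.Nat using (ℕ; zero; suc; _≤_)
open import Data.Fin using (Fin; zero; suc)
open import Data.Product using (Σ; ∃; _×_; _,_)
open import Data.Sum using (_⊎_)
open import Relation.Nullary using (¬_)
open import Relation.Unary using (Pred)
open import Relation.Binary using (Decidable)
open import Relation.Binary.PropositionalEquality using (_≡_)
open import Algebra.Bundles using (CommutativeRing)
open import Algebra.Bundles.Raw using (RawRing)

-- Only the operations and the equality of S are needed to *state*
-- these notions; they are used for R, R_i and R_i/M_i.

module _ {c ℓ : Level} (S : RawRing c ℓ) where
  open RawRing S

  Vect : ℕ → Set c
  Vect n = Fin n → Carrier

  _≋_ : ∀ {n} → Vect n → Vect n → Set ℓ
  v ≋ w = ∀ j → v j ≈ w j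

  ∑ : ∀ {m} → (Fin m → Carrier) → Carrier
  ∑ {zero}  f = 0#
  ∑ {suc m} f = f zero + ∑ (λ t → f (suc t))

  δ : ∀ {m} → Fin m → Fin m → Carrier
  δ zero    zero    = 1#
  δ zero    (suc _) = 0#
  δ (suc _) zero    = 0#
  δ (suc s) (suc t) = δ s t

  lincomb : ∀ {k n} → (Fin k → Carrier) → (Fin k → Vect n) → Vect n
  lincomb cs V j = ∑ (λ t → cs t * V t j)

  InSpan : ∀ {k n} → (Fin k → Vect n) → Vect n → Set (c ⊔ ℓ)
  InSpan V w = ∃ λ cs → w ≋ lincomb cs V

  SpansAll : ∀ {k n} → (Fin k → Vect n) → Set (c ⊔ ℓ)
  SpansAll V = ∀ w → InSpan V w

  Unimodular : ∀ {m n} → (Fin m → Vect n) → Set (c ⊔ ℓ)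
  Unimodular {m} {n} V =
    ∃ λ (B : Fin n → Fin m → Carrier) →
      ∀ s t → ∑ (λ j → V s j * B j t) ≈ δ s t

  single : ∀ {n} → Vect n → Fin 1 → Vect n
  single α _ = α

  IsPoint : ∀ {n} → Vect n → Set (c ⊔ ℓ)
  IsPoint α = Unimodular (single α)

  SamePoint : ∀ {n} → Vect n → Vect n → Set (c ⊔ ℓ)
  SamePoint α β = ∀ w → (InSpan (single α) w → InSpan (single β) w)
                      × (InSpan (single β) w → InSpan (single α) w)

  record IsArc (n k : ℕ) (P : Fin k → Vect n) : Set (c ⊔ ℓ) where
    field
      points   : ∀ t → IsPoint (P t)
      distinct : ∀ t u → SamePoint (P t) (P u) → t ≡ u
      size     : suc n ≤ k
      spanning : (f : Fin n → Fin k) → (∀ a b → f a ≡ f b → a ≡ b) →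
                 SpansAll (λ a → P (f a))

  PointsIncluded : ∀ {n k k'} → (Fin k → Vect n) → (Fin k' → Vect n) → Set (c ⊔ ℓ)
  PointsIncluded P Q = ∀ t → ∃ λ u → SamePoint (P t) (Q u)

  IsComplete : (n k : ℕ) → (Fin k → Vect n) → Set (c ⊔ ℓ)
  IsComplete n k P = ∀ k' (Q : Fin k' → Vect n) → IsArc n k' Q →
                     PointsIncluded P Q → PointsIncluded Q P

module _ {c ℓ : Level} (R : CommutativeRing c ℓ) where
  open CommutativeRing R

  record IsIdeal (I : Pred Carrier ℓ) : Set (c ⊔ ℓ) where
    field
      resp  : ∀ {x y} → x ≈ y → I x → I y
      zero∈ : I 0#
      +-cl  : ∀ {x y} → I x → I y → I (x + y)
      *-cl  : ∀ r {x} → I x → I (r * x)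

  record IsMaximalIdeal (I : Pred Carrier ℓ) : Set (c ⊔ lsuc ℓ) where
    field
      ideal   : IsIdeal I
      proper  : ¬ I 1#
      maximal : ∀ (J : Pred Carrier ℓ) → IsIdeal J → (∀ x → I x → J x) →
                (∀ x → J x → I x) ⊎ (∀ x → J x)

  record IsLocalWith (M : Pred Carrier ℓ) : Set (c ⊔ lsuc ℓ) where
    field
      maximalIdeal : IsMaximalIdeal M
      unique       : ∀ (J : Pred Carrier ℓ) → IsMaximalIdeal J →
                     ∀ x → (J x → M x) × (M x → J x)

  record IsFinite : Set (c ⊔ ℓ) where
    field
      size  : ℕ
      enum  : Fin size → Carrier
      onto  : ∀ x → ∃ λ j → enum j ≈ x
      _≟_   : Decidable _≈_

  residue : Pred Carrier ℓ → RawRing c ℓ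
  residue M = record
    { Carrier = Carrier
    ; _≈_     = λ x y → M (x - y)
    ; _+_     = _+_
    ; _*_     = _*_
    ; -_      = -_
    ; 0#      = 0#
    ; 1#      = 1#
    }

module _ {c ℓ : Level} {L : ℕ} (Rs : Fin L → CommutativeRing c ℓ) where
  open CommutativeRing

  productRing : RawRing c ℓ
  productRing = record
    { Carrier = (i : Fin L) → Carrier (Rs i)
    ; _≈_     = λ x y → ∀ i → _≈_ (Rs i) (x i) (y i)
    ; _+_     = λ x y i → _+_ (Rs i) (x i) (y i)
    ; _*_     = λ x y i → _*_ (Rs i) (x i) (y i)
    ; -_      = λ x i → -_ (Rs i) (x i)
    ; 0#      = λ i → 0# (Rs i)
    ; 1#      = λ i → 1# (Rs i)
    }

  ρ : ∀ {n} (i : Fin L) → Vect productRing n → Vect (rawRing (Rs i)) n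
  ρ i α j = α j i

  -- π_i ∘ ρ_i applied entrywise: the carrier of R_i/M_i is that of R_i,
  -- so π_i is the identity on representatives
  πρ : ∀ {n} (i : Fin L) (M : Pred (Carrier (Rs i)) ℓ) →
       Vect productRing n → Vect (residue (Rs i) M) n
  πρ i M α j = α j i

-- Over a finite local ring R with maximal ideal M, Nakayama's lemma makes spanning R^n the same
-- as spanning (R/M)^n, and a counting argument shows that fewer than n vectors never span R^n.
-- Hence an arc over R_i/M_i is already an arc over R_i, and the projections of an arc over
-- R = R_1 × ... × R_ℓ are arcs: two of their points cannot coincide, for then n of the points
-- would lie in the span of n - 1 vectors. Conversely, arcs over the factors glue to an arc over R.
-- If some residue arc is complete, a larger arc over R projects to a larger arc over that field
-- and so adds no point; if none is, extending every residue arc by a new point and gluing the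
-- lifts extends the arc over R. The classical case split is available because the maximality of
-- M, stated for predicates of level ℓ, decides every proposition of that level.
module Submission where

open import Level using (Level; _⊔_)
open import Data.Nat using (ℕ; zero; suc; _≤_; _<_; s≤s; z≤n; _^_)
open import Data.Nat.Properties using (≤-refl; ≤-trans; n≤1+n; m≤n⇒m≤1+n; ^-monoʳ-<)
open import Data.Fin using (Fin; zero; suc; fromℕ<; punchIn; punchOut; inject≤; funToFin; finToFun; combine)
open import Data.Fin.Properties
  using (any?; 0≢1+n; <⇒notInjective; funToFin-finToFin; finToFun-funToFin;
         punchIn-injective; punchInᵢ≢i; punchIn-punchOut; inject≤-injective)
  renaming (_≟_ to _≟ᶠ_)
open import Data.Vec.Functional using (_∷_)
open import Data.Maybe using (nothing)
open import Data.Product using (Σ; ∃; _×_; _,_; proj₁; proj₂)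
open import Data.Sum using (_⊎_; inj₁; inj₂; [_,_]′)
open import Data.Empty using (⊥; ⊥-elim)
open import Relation.Nullary using (¬_; Dec; yes; no)
open import Relation.Unary using (Pred)
open import Relation.Binary using (Setoid; Decidable)
open import Relation.Binary.PropositionalEquality as ≡ using (_≡_)
open import Algebra.Bundles using (CommutativeRing; Ring)
open import Algebra.Bundles.Raw using (RawRing)
open import Algebra.Solver.Ring.AlmostCommutativeRing using (fromCommutativeRing; -raw-almostCommutative⟶)
open import Function.Base using (case_of_)
open import Function.Bundles using (_⇔_; mk⇔)
open import Defs

module _ {c ℓ : Level} {S : RawRing c ℓ} where

  samePoint-refl : ∀ {n} {α : Vect S n} → SamePoint S α α
  samePoint-refl w = (λ w∈ → w∈) , (λ w∈ → w∈)

  samePoint-sym : ∀ {n} {α β : Vect S n} → SamePoint S α β → SamePoint S β α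
  samePoint-sym α~β w = proj₂ (α~β w) , proj₁ (α~β w)

  samePoint-trans : ∀ {n} {α β γ : Vect S n} → SamePoint S α β → SamePoint S β γ → SamePoint S α γ
  samePoint-trans α~β β~γ w = (λ w∈ → proj₁ (β~γ w) (proj₁ (α~β w) w∈)) , (λ w∈ → proj₂ (α~β w) (proj₂ (β~γ w) w∈))

module LinearAlgebra {c ℓ : Level} (S : CommutativeRing c ℓ) where
  open CommutativeRing S hiding (zero)
  open import Relation.Binary.Reasoning.Setoid setoid
  open import Algebra.Solver.Ring rawRing (fromCommutativeRing S)
    (-raw-almostCommutative⟶ (fromCommutativeRing S)) (λ _ _ → nothing)
  open import Algebra.Properties.AbelianGroup +-abelianGroup using (⁻¹-anti-homo‿-; ⁻¹-∙-comm)

  ∑ₛ : ∀ {m} → (Fin m → Carrier) → Carrier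
  ∑ₛ = ∑ rawRing

  δₛ : ∀ {m} → Fin m → Fin m → Carrier
  δₛ = δ rawRing

  -‿+ : ∀ x y → - (x + y) ≈ - x + - y
  -‿+ x y = sym (⁻¹-∙-comm x y)

  x-y+y≈x : ∀ x y → (x - y) + y ≈ x
  x-y+y≈x x y = trans (+-assoc x (- y) y) (trans (+-congˡ (-‿inverseˡ y)) (+-identityʳ x))

  x-[x-y]≈y : ∀ x y → x - (x - y) ≈ y
  x-[x-y]≈y x y = trans (+-congˡ (⁻¹-anti-homo‿- x y)) (trans (+-comm x (y - x)) (x-y+y≈x y x))

  x-y+[y-z]≈x-z : ∀ x y z → (x - y) + (y - z) ≈ x - z
  x-y+[y-z]≈x-z x y z = begin
    (x - y) + (y - z)     ≈⟨ solve 4 (λ x -y y -z → (x :+ -y) :+ (y :+ -z) := x :+ ((-y :+ y) :+ -z)) refl x (- y) y (- z) ⟩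
    x + ((- y + y) - z)   ≈⟨ +-congˡ (trans (+-congʳ (-‿inverseˡ y)) (+-identityˡ (- z))) ⟩
    x - z ∎

  ∑-cong : ∀ {m} {f g : Fin m → Carrier} → (∀ t → f t ≈ g t) → ∑ₛ f ≈ ∑ₛ g
  ∑-cong {zero}  f≈g = refl
  ∑-cong {suc m} f≈g = +-cong (f≈g zero) (∑-cong (λ t → f≈g (suc t)))

  ∑-zero : ∀ {m} (f : Fin m → Carrier) → (∀ t → f t ≈ 0#) → ∑ₛ f ≈ 0#
  ∑-zero {zero}  f f≈0 = refl
  ∑-zero {suc m} f f≈0 = trans (+-cong (f≈0 zero) (∑-zero _ (λ t → f≈0 (suc t)))) (+-identityˡ 0#)

  ∑-+ : ∀ {m} (f g : Fin m → Carrier) → ∑ₛ (λ t → f t + g t) ≈ ∑ₛ f + ∑ₛ g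
  ∑-+ {zero}  f g = sym (+-identityˡ 0#)
  ∑-+ {suc m} f g = begin
    (f zero + g zero) + ∑ₛ (λ t → f (suc t) + g (suc t))
      ≈⟨ +-congˡ (∑-+ (λ t → f (suc t)) (λ t → g (suc t))) ⟩
    (f zero + g zero) + (∑ₛ (λ t → f (suc t)) + ∑ₛ (λ t → g (suc t)))
      ≈⟨ solve 4 (λ a b x y → (a :+ b) :+ (x :+ y) := (a :+ x) :+ (b :+ y)) refl (f zero) (g zero) _ _ ⟩
    (f zero + ∑ₛ (λ t → f (suc t))) + (g zero + ∑ₛ (λ t → g (suc t))) ∎

  ∑-*ˡ : ∀ {m} a (f : Fin m → Carrier) → ∑ₛ (λ t → a * f t) ≈ a * ∑ₛ f
  ∑-*ˡ {zero}  a f = sym (zeroʳ a)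
  ∑-*ˡ {suc m} a f = trans (+-congˡ (∑-*ˡ a (λ t → f (suc t)))) (sym (distribˡ a _ _))

  ∑-δˡ : ∀ {m} (s : Fin m) (f : Fin m → Carrier) → ∑ₛ (λ t → δₛ s t * f t) ≈ f s
  ∑-δˡ {suc m} zero f = begin
    1# * f zero + ∑ₛ (λ t → 0# * f (suc t))
      ≈⟨ +-cong (*-identityˡ _) (∑-zero _ (λ t → zeroˡ (f (suc t)))) ⟩
    f zero + 0# ≈⟨ +-identityʳ _ ⟩
    f zero ∎
  ∑-δˡ {suc m} (suc s) f = begin
    0# * f zero + ∑ₛ (λ t → δₛ s t * f (suc t)) ≈⟨ +-cong (zeroˡ _) (∑-δˡ s (λ t → f (suc t))) ⟩
    0# + f (suc s)                              ≈⟨ +-identityˡ _ ⟩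
    f (suc s) ∎

  δ-sym : ∀ {m} (s t : Fin m) → δₛ s t ≡ δₛ t s
  δ-sym zero    zero    = ≡.refl
  δ-sym zero    (suc t) = ≡.refl
  δ-sym (suc s) zero    = ≡.refl
  δ-sym (suc s) (suc t) = δ-sym s t

  ∑-δʳ : ∀ {m} (s : Fin m) (f : Fin m → Carrier) → ∑ₛ (λ t → f t * δₛ t s) ≈ f s
  ∑-δʳ s f = trans (∑-cong (λ t → trans (*-comm (f t) _) (reflexive (≡.cong (_* f t) (δ-sym t s))))) (∑-δˡ s f)

  record IsSubmodule {n p} (N : Vect rawRing n → Set p) : Set (c ⊔ ℓ ⊔ p) where
    field
      resp   : ∀ {v w} → _≋_ rawRing v w → N v → N w
      0∈     : N (λ _ → 0#)
      +-cl   : ∀ {v w} → N v → N w → N (λ j → v j + w j)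
      *-cl   : ∀ a {v} → N v → N (λ j → a * v j)

  lincomb∈ : ∀ {k n p} {N : Vect rawRing n → Set p} → IsSubmodule N →
             (cs : Fin k → Carrier) (V : Fin k → Vect rawRing n) → (∀ t → N (V t)) →
             N (lincomb rawRing cs V)
  lincomb∈ {zero}  sub cs V V∈ = IsSubmodule.0∈ sub
  lincomb∈ {suc k} sub cs V V∈ = IsSubmodule.+-cl sub (IsSubmodule.*-cl sub (cs zero) (V∈ zero))
    (lincomb∈ sub (λ t → cs (suc t)) (λ t → V (suc t)) (λ t → V∈ (suc t)))

  span-isSubmodule : ∀ {k n} (V : Fin k → Vect rawRing n) → IsSubmodule (InSpan rawRing V)
  span-isSubmodule V = record
    { resp = λ v≋w (cs , v≋) → cs , λ j → trans (sym (v≋w j)) (v≋ j)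
    ; 0∈   = (λ _ → 0#) , λ j → sym (∑-zero _ (λ t → zeroˡ (V t j)))
    ; +-cl = λ (cs , v≋) (ds , w≋) → (λ t → cs t + ds t) , λ j → trans (+-cong (v≋ j) (w≋ j))
               (sym (trans (∑-cong (λ t → distribʳ (V t j) (cs t) (ds t)))
                 (∑-+ (λ t → cs t * V t j) (λ t → ds t * V t j))))
    ; *-cl = λ a (cs , v≋) → (λ t → a * cs t) , λ j → trans (*-congˡ (v≋ j))
               (sym (trans (∑-cong (λ t → *-assoc a (cs t) (V t j))) (∑-*ˡ a (λ t → cs t * V t j))))
    }

  generator∈span : ∀ {k n} (V : Fin k → Vect rawRing n) t → InSpan rawRing V (V t)
  generator∈span V t = δₛ t , λ j → sym (∑-δˡ t (λ u → V u j))

  spansAll-by-spanning : ∀ {k k' n} (V : Fin k → Vect rawRing n) (W : Fin k' → Vect rawRing n) →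
                         SpansAll rawRing W → (∀ a → InSpan rawRing V (W a)) → SpansAll rawRing V
  spansAll-by-spanning V W W-spans W⊆V w =
    let (cs , w≋) = W-spans w in
    IsSubmodule.resp sub (λ j → sym (w≋ j)) (lincomb∈ sub cs W W⊆V)
    where sub = span-isSubmodule V

  IsMultipleOf : ∀ {n} → Vect rawRing n → Vect rawRing n → Set (c ⊔ ℓ)
  IsMultipleOf α w = ∃ λ a → ∀ j → w j ≈ a * α j

  multiple∈span : ∀ {k n} (V : Fin k → Vect rawRing n) a {w} → IsMultipleOf (V a) w → InSpan rawRing V w
  multiple∈span V a (c , w≋) = IsSubmodule.resp sub (λ j → sym (w≋ j)) (IsSubmodule.*-cl sub c (generator∈span V a))
    where sub = span-isSubmodule V

  ∈single⇒multiple : ∀ {n} {α w : Vect rawRing n} → InSpan rawRing (single rawRing α) w → IsMultipleOf α w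
  ∈single⇒multiple (cs , w≋) = cs zero , λ j → trans (w≋ j) (+-identityʳ _)

  multiple⇒∈single : ∀ {n} {α w : Vect rawRing n} → IsMultipleOf α w → InSpan rawRing (single rawRing α) w
  multiple⇒∈single (a , w≋) = (λ _ → a) , λ j → trans (w≋ j) (sym (+-identityʳ _))

  multiple-trans : ∀ {n} {α β γ : Vect rawRing n} → IsMultipleOf α β → IsMultipleOf β γ → IsMultipleOf α γ
  multiple-trans {α = α} (a , β≋) (b , γ≋) = b * a , λ j → trans (γ≋ j) (trans (*-congˡ (β≋ j)) (sym (*-assoc b a (α j))))

  samePoint⇒multiple : ∀ {n} {α β : Vect rawRing n} → SamePoint rawRing α β → IsMultipleOf β α
  samePoint⇒multiple {α = α} α~β = ∈single⇒multiple (proj₁ (α~β α) (generator∈span (single rawRing α) zero))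

  multiples⇒samePoint : ∀ {n} {α β : Vect rawRing n} → IsMultipleOf β α → IsMultipleOf α β → SamePoint rawRing α β
  multiples⇒samePoint β∣α α∣β w =
    (λ w∈ → multiple⇒∈single (multiple-trans β∣α (∈single⇒multiple w∈))) ,
    (λ w∈ → multiple⇒∈single (multiple-trans α∣β (∈single⇒multiple w∈)))

  ≋⇒samePoint : ∀ {n} {α β : Vect rawRing n} → _≋_ rawRing α β → SamePoint rawRing α β
  ≋⇒samePoint α≋β = multiples⇒samePoint (1# , λ j → trans (α≋β j) (sym (*-identityˡ _)))
                                        (1# , λ j → trans (sym (α≋β j)) (sym (*-identityˡ _)))

InjectiveFin : ∀ {m k} → (Fin m → Fin k) → Set
InjectiveFin f = ∀ a b → f a ≡ f b → a ≡ b

EveryNSpan : ∀ {c ℓ} (S : RawRing c ℓ) (n k : ℕ) → (Fin k → Vect S n) → Set (c ⊔ ℓ)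
EveryNSpan S n k P = (f : Fin n → Fin k) → InjectiveFin f → SpansAll S (λ a → P (f a))

injection-through : ∀ {n k} → suc (suc n) ≤ k → (t u : Fin k) → ¬ t ≡ u →
                    Σ (Fin (suc (suc n)) → Fin k) λ f → InjectiveFin f × f zero ≡ t × f (suc zero) ≡ u
injection-through {n} {suc (suc k)} (s≤s (s≤s n≤k)) t u t≢u = f , f-injective , ≡.refl , ≡.refl
  where
  u′ = punchOut t≢u
  g : Fin n → Fin (suc (suc k))
  g j = punchIn t (punchIn u′ (inject≤ j n≤k))
  f : Fin (suc (suc n)) → Fin (suc (suc k))
  f zero          = t
  f (suc zero)    = u
  f (suc (suc j)) = g j
  u≢g : ∀ j → ¬ u ≡ g j
  u≢g j eq = punchInᵢ≢i u′ _ (≡.sym (punchIn-injective t _ _ (≡.trans (punchIn-punchOut t≢u) eq)))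
  f-injective : InjectiveFin f
  f-injective zero          zero           eq = ≡.refl
  f-injective zero          (suc zero)     eq = ⊥-elim (t≢u eq)
  f-injective zero          (suc (suc j))  eq = ⊥-elim (punchInᵢ≢i t _ (≡.sym eq))
  f-injective (suc zero)    zero           eq = ⊥-elim (t≢u (≡.sym eq))
  f-injective (suc zero)    (suc zero)     eq = ≡.refl
  f-injective (suc zero)    (suc (suc j))  eq = ⊥-elim (u≢g j eq)
  f-injective (suc (suc j)) zero           eq = ⊥-elim (punchInᵢ≢i t _ eq)
  f-injective (suc (suc j)) (suc zero)     eq = ⊥-elim (u≢g j (≡.sym eq))
  f-injective (suc (suc j)) (suc (suc j′)) eq = ≡.cong (λ x → suc (suc x))
    (inject≤-injective _ _ j j′ (punchIn-injective u′ _ _ (punchIn-injective t _ _ eq)))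

∃⊎∀ : ∀ {p q m} {P : Fin m → Set p} {Q : Fin m → Set q} → (∀ i → P i ⊎ Q i) → ∃ P ⊎ (∀ i → Q i)
∃⊎∀ {m = zero}  P⊎Q = inj₂ (λ ())
∃⊎∀ {m = suc m} P⊎Q with P⊎Q zero | ∃⊎∀ (λ i → P⊎Q (suc i))
... | inj₁ p | _            = inj₁ (zero , p)
... | inj₂ _ | inj₁ (i , p) = inj₁ (suc i , p)
... | inj₂ q | inj₂ qs      = inj₂ λ { zero → q ; (suc i) → qs i }

module _ {a ℓ : Level} (S : Setoid a ℓ) (_≟_ : Decidable (Setoid._≈_ S)) where
  open Setoid S

  distinctRepresentatives : ∀ {s} (f : Fin s → Carrier) →
    Σ ℕ λ s′ → Σ (Fin s′ → Carrier) λ rep → (∀ a b → rep a ≈ rep b → a ≡ b) × (∀ j → ∃ λ a → rep a ≈ f j)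
  distinctRepresentatives {zero}  f = zero , (λ ()) , (λ ()) , (λ ())
  distinctRepresentatives {suc s} f
    with distinctRepresentatives (λ j → f (suc j))
  ... | s′ , rep , rep-inj , rep-onto
    with any? (λ a → rep a ≟ f zero)
  ... | yes (a , rep≈) = s′ , rep , rep-inj , onto
    where
    onto : ∀ j → ∃ λ a → rep a ≈ f j
    onto zero    = a , rep≈
    onto (suc j) = rep-onto j
  ... | no ¬rep≈ = suc s′ , f zero ∷ rep , inj , onto
    where
    inj : ∀ a b → (f zero ∷ rep) a ≈ (f zero ∷ rep) b → a ≡ b
    inj zero    zero    _  = ≡.refl
    inj zero    (suc b) eq = ⊥-elim (¬rep≈ (b , sym eq))
    inj (suc a) zero    eq = ⊥-elim (¬rep≈ (a , eq))
    inj (suc a) (suc b) eq = ≡.cong suc (rep-inj a b eq)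
    onto : ∀ j → ∃ λ a → (f zero ∷ rep) a ≈ f j
    onto zero    = zero , refl
    onto (suc j) = let (a , rep≈) = rep-onto j in suc a , rep≈

-- Vectors over q distinct representatives give q ^ n pairwise distinct vectors of R^n; a spanning
-- family of m vectors would code each of them injectively by its q ^ m coefficient tuples.
module FiniteRing {c ℓ : Level} (R : CommutativeRing c ℓ) (fin : IsFinite R)
                  (1≉0 : ¬ CommutativeRing._≈_ R (CommutativeRing.1# R) (CommutativeRing.0# R)) where
  open CommutativeRing R hiding (zero)
  open IsFinite fin
  open LinearAlgebra R using (∑-cong)

  private
    reps = distinctRepresentatives setoid _≟_ enum
    q = proj₁ reps
    rep = proj₁ (proj₂ reps)
    rep-injective = proj₁ (proj₂ (proj₂ reps))

    rep-onto : ∀ x → ∃ λ a → rep a ≈ x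
    rep-onto x = let (j , enum≈) = onto x ; (a , rep≈) = proj₂ (proj₂ (proj₂ reps)) j in a , trans rep≈ enum≈

    2≤q : 2 ≤ q
    2≤q with rep-onto 0# | rep-onto 1#
    ... | a , rep≈0 | b , rep≈1 = distinct⇒2≤ a b λ a≡b →
      1≉0 (trans (sym rep≈1) (trans (reflexive (≡.cong rep (≡.sym a≡b))) rep≈0))
      where
      distinct⇒2≤ : ∀ {m} (a b : Fin m) → ¬ a ≡ b → 2 ≤ m
      distinct⇒2≤ {suc zero}    zero zero a≢b = ⊥-elim (a≢b ≡.refl)
      distinct⇒2≤ {suc (suc m)} _    _    _   = s≤s (s≤s z≤n)

    funToFin-cong : ∀ {m k} {f g : Fin m → Fin k} → (∀ i → f i ≡ g i) → funToFin f ≡ funToFin g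
    funToFin-cong {zero}  f≡g = ≡.refl
    funToFin-cong {suc m} f≡g = ≡.cong₂ combine (f≡g zero) (funToFin-cong (λ i → f≡g (suc i)))

  ¬spansAll-fewer : ∀ {m n} → m < n → (W : Fin m → Vect rawRing n) → ¬ SpansAll rawRing W
  ¬spansAll-fewer {m} {n} m<n W W-spans = <⇒notInjective (^-monoʳ-< q 2≤q m<n) code-injective
    where
    vec : Fin (q ^ n) → Vect rawRing n
    vec x j = rep (finToFun x j)
    coeff : Fin (q ^ n) → Fin m → Fin q
    coeff x t = proj₁ (rep-onto (proj₁ (W-spans (vec x)) t))
    code : Fin (q ^ n) → Fin (q ^ m)
    code x = funToFin (coeff x)
    code-injective : ∀ {x y} → code x ≡ code y → x ≡ y
    code-injective {x} {y} eq = begin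
      x                             ≡⟨ ≡.sym (funToFin-finToFin {n} {q} x) ⟩
      funToFin (finToFun {q} {n} x) ≡⟨ funToFin-cong (λ j → rep-injective _ _ (vec≈ j)) ⟩
      funToFin (finToFun {q} {n} y) ≡⟨ funToFin-finToFin {n} {q} y ⟩
      y ∎
      where
      open ≡.≡-Reasoning
      coeff≡ : ∀ t → coeff x t ≡ coeff y t
      coeff≡ t = ≡.trans (≡.sym (finToFun-funToFin (coeff x) t))
                   (≡.trans (≡.cong (λ z → finToFun z t) eq) (finToFun-funToFin (coeff y) t))
      coefficient≈ : ∀ z t → rep (coeff z t) ≈ proj₁ (W-spans (vec z)) t
      coefficient≈ z t = proj₂ (rep-onto _)
      vec≈ : ∀ j → vec x j ≈ vec y j
      vec≈ j = trans (proj₂ (W-spans (vec x)) j) (trans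
        (∑-cong (λ t → *-congʳ (trans (sym (coefficient≈ x t))
                        (trans (reflexive (≡.cong rep (coeff≡ t))) (coefficient≈ y t)))))
        (sym (proj₂ (W-spans (vec y)) j)))

-- The ideal "M, or everything if P" contains M, so maximality of M decides P.
maximalIdeal⇒decidable : ∀ {c ℓ} (R : CommutativeRing c ℓ) {M : Pred (CommutativeRing.Carrier R) ℓ} →
                         IsMaximalIdeal R M → (P : Set ℓ) → Dec P
maximalIdeal⇒decidable R {M} isMax P with maximal M∪P M∪P-isIdeal (λ _ → inj₁)
  where
  open CommutativeRing R
  open IsMaximalIdeal isMax
  open IsIdeal ideal
  M∪P : Pred Carrier _
  M∪P x = M x ⊎ P
  M∪P-isIdeal : IsIdeal R M∪P
  M∪P-isIdeal = record
    { resp  = λ { x≈y (inj₁ x∈M) → inj₁ (resp x≈y x∈M) ; _ (inj₂ p) → inj₂ p }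
    ; zero∈ = inj₁ zero∈
    ; +-cl  = λ { (inj₁ x∈M) (inj₁ y∈M) → inj₁ (+-cl x∈M y∈M) ; (inj₂ p) _ → inj₂ p ; _ (inj₂ p) → inj₂ p }
    ; *-cl  = λ { r (inj₁ x∈M) → inj₁ (*-cl r x∈M) ; r (inj₂ p) → inj₂ p }
    }
... | inj₁ M∪P⊆M = no λ p → IsMaximalIdeal.proper isMax (M∪P⊆M _ (inj₂ p))
... | inj₂ everything with everything (CommutativeRing.1# R)
...   | inj₁ 1∈M = ⊥-elim (IsMaximalIdeal.proper isMax 1∈M)
...   | inj₂ p   = yes p

module LocalRing {c ℓ : Level} (R : CommutativeRing c ℓ) (M : Pred (CommutativeRing.Carrier R) ℓ)
                 (fin : IsFinite R) (loc : IsLocalWith R M) where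
  open CommutativeRing R hiding (zero)
  open import Relation.Binary.Reasoning.Setoid setoid
  open IsFinite fin using (size; enum; onto)
  open IsLocalWith loc
  open IsMaximalIdeal maximalIdeal using (proper)
  open import Algebra.Solver.Ring rawRing (fromCommutativeRing R)
    (-raw-almostCommutative⟶ (fromCommutativeRing R)) (λ _ _ → nothing)
  open import Algebra.Properties.Ring ring using (-1*x≈-x)
  open import Algebra.Properties.RingWithoutOne (Ring.ringWithoutOne ring) using (x[y-z]≈xy-xz; [y-z]x≈yx-zx)
  open import Algebra.Properties.AbelianGroup +-abelianGroup using (⁻¹-anti-homo‿-)
  open LinearAlgebra R
  private
    module MI = IsIdeal (IsMaximalIdeal.ideal maximalIdeal)

  decide : (P : Set ℓ) → Dec P
  decide = maximalIdeal⇒decidable R maximalIdeal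

  -- I + R a; the elements of I and R range over the enumeration, keeping the predicate in level ℓ.
  adjoin : Pred Carrier ℓ → Carrier → Pred Carrier ℓ
  adjoin I a y = Σ (Fin size) λ b → Σ (Fin size) λ d → I (enum b) × y ≈ enum b + enum d * a

  adjoin-isIdeal : ∀ {I} a → IsIdeal R I → IsIdeal R (adjoin I a)
  adjoin-isIdeal {I} a I-ideal = record
    { resp  = λ x≈y (b , d , b∈I , x≈) → b , d , b∈I , trans (sym x≈y) x≈
    ; zero∈ = let (b , b≈) = onto 0# ; (d , d≈) = onto 0# in
        b , d , I.resp (sym b≈) I.zero∈ ,
        sym (trans (+-cong b≈ (trans (*-congʳ d≈) (zeroˡ a))) (+-identityˡ 0#))
    ; +-cl  = +-closed
    ; *-cl  = *-closed
    }
    where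
    module I = IsIdeal I-ideal
    +-closed : ∀ {x y} → adjoin I a x → adjoin I a y → adjoin I a (x + y)
    +-closed {x} {y} (b , d , b∈I , x≈) (b′ , d′ , b′∈I , y≈) =
      let (b″ , b″≈) = onto (enum b + enum b′) ; (d″ , d″≈) = onto (enum d + enum d′) in
      b″ , d″ , I.resp (sym b″≈) (I.+-cl b∈I b′∈I) , (begin
        x + y                                            ≈⟨ +-cong x≈ y≈ ⟩
        (enum b + enum d * a) + (enum b′ + enum d′ * a)
          ≈⟨ solve 5 (λ B D A B′ D′ → (B :+ D :* A) :+ (B′ :+ D′ :* A) := (B :+ B′) :+ (D :+ D′) :* A)
                     refl (enum b) (enum d) a (enum b′) (enum d′) ⟩
        (enum b + enum b′) + (enum d + enum d′) * a      ≈⟨ sym (+-cong b″≈ (*-congʳ d″≈)) ⟩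
        enum b″ + enum d″ * a ∎)
    *-closed : ∀ r {x} → adjoin I a x → adjoin I a (r * x)
    *-closed r {x} (b , d , b∈I , x≈) =
      let (b″ , b″≈) = onto (r * enum b) ; (d″ , d″≈) = onto (r * enum d) in
      b″ , d″ , I.resp (sym b″≈) (I.*-cl r b∈I) , (begin
        r * x                           ≈⟨ *-congˡ x≈ ⟩
        r * (enum b + enum d * a)       ≈⟨ trans (distribˡ r _ _) (+-congˡ (sym (*-assoc r (enum d) a))) ⟩
        r * enum b + (r * enum d) * a   ≈⟨ sym (+-cong b″≈ (*-congʳ d″≈)) ⟩
        enum b″ + enum d″ * a ∎)

  ⊆-adjoin : ∀ {I} a → IsIdeal R I → ∀ y → I y → adjoin I a y
  ⊆-adjoin a I-ideal y y∈I = let (b , b≈) = onto y ; (d , d≈) = onto 0# in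
    b , d , IsIdeal.resp I-ideal (sym b≈) y∈I ,
    sym (trans (+-cong b≈ (trans (*-congʳ d≈) (zeroˡ a))) (+-identityʳ y))

  ∈-adjoin : ∀ {I} a → IsIdeal R I → adjoin I a a
  ∈-adjoin a I-ideal = let (b , b≈) = onto 0# ; (d , d≈) = onto 1# in
    b , d , IsIdeal.resp I-ideal (sym b≈) (IsIdeal.zero∈ I-ideal) ,
    sym (trans (+-cong b≈ (trans (*-congʳ d≈) (*-identityˡ a))) (+-identityˡ a))

  adjoin-mono : ∀ {I J} a → (∀ y → I y → J y) → ∀ y → adjoin I a y → adjoin J a y
  adjoin-mono a I⊆J y (b , d , b∈I , y≈) = b , d , I⊆J _ b∈I , y≈

  record ProperIdeal : Set (c ⊔ Level.suc ℓ) where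
    field
      I       : Pred Carrier ℓ
      isIdeal : IsIdeal R I
      1∉I     : ¬ I 1#

  open ProperIdeal

  adjoinIfProper : ProperIdeal → Carrier → ProperIdeal
  adjoinIfProper 𝔞 a with decide (adjoin (I 𝔞) a 1#)
  ... | yes _ = 𝔞
  ... | no 1∉ = record { I = adjoin (I 𝔞) a ; isIdeal = adjoin-isIdeal a (isIdeal 𝔞) ; 1∉I = 1∉ }

  ⊆-adjoinIfProper : ∀ 𝔞 a y → I 𝔞 y → I (adjoinIfProper 𝔞 a) y
  ⊆-adjoinIfProper 𝔞 a y y∈ with decide (adjoin (I 𝔞) a 1#)
  ... | yes _ = y∈
  ... | no _  = ⊆-adjoin a (isIdeal 𝔞) y y∈

  ∈-adjoinIfProper : ∀ 𝔞 a → ¬ adjoin (I 𝔞) a 1# → I (adjoinIfProper 𝔞 a) a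
  ∈-adjoinIfProper 𝔞 a 1∉ with decide (adjoin (I 𝔞) a 1#)
  ... | yes 1∈ = ⊥-elim (1∉ 1∈)
  ... | no _   = ∈-adjoin a (isIdeal 𝔞)

  saturate : ∀ {m} → (Fin m → Carrier) → ProperIdeal → ProperIdeal
  saturate {zero}  xs 𝔞 = 𝔞
  saturate {suc m} xs 𝔞 = saturate (λ t → xs (suc t)) (adjoinIfProper 𝔞 (xs zero))

  ⊆-saturate : ∀ {m} (xs : Fin m → Carrier) 𝔞 y → I 𝔞 y → I (saturate xs 𝔞) y
  ⊆-saturate {zero}  xs 𝔞 y y∈ = y∈
  ⊆-saturate {suc m} xs 𝔞 y y∈ = ⊆-saturate (λ t → xs (suc t)) _ y (⊆-adjoinIfProper 𝔞 (xs zero) y y∈)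

  ∈-saturate : ∀ {m} (xs : Fin m → Carrier) 𝔞 t → ¬ adjoin (I (saturate xs 𝔞)) (xs t) 1# → I (saturate xs 𝔞) (xs t)
  ∈-saturate {suc m} xs 𝔞 zero 1∉ = ⊆-saturate (λ t → xs (suc t)) _ (xs zero)
    (∈-adjoinIfProper 𝔞 (xs zero) λ 1∈ → 1∉
      (adjoin-mono (xs zero) (λ y y∈ → ⊆-saturate (λ t → xs (suc t)) (adjoinIfProper 𝔞 (xs zero)) y
                                          (⊆-adjoinIfProper 𝔞 (xs zero) y y∈)) 1# 1∈))
  ∈-saturate {suc m} xs 𝔞 (suc t) 1∉ = ∈-saturate (λ t → xs (suc t)) _ t 1∉

  -- An ideal J strictly above saturate enum 𝔞 contains some enum a outside it; adjoining enum a
  -- was rejected, so 1 ∈ saturate enum 𝔞 + R (enum a) ⊆ J.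
  saturate-isMaximal : (𝔞 : ProperIdeal) → IsMaximalIdeal R (I (saturate enum 𝔞))
  saturate-isMaximal 𝔞 = record { ideal = isIdeal 𝔪 ; proper = 1∉I 𝔪 ; maximal = isMaximal }
    where
    𝔪 = saturate enum 𝔞
    isMaximal : ∀ J → IsIdeal R J → (∀ x → I 𝔪 x → J x) → (∀ x → J x → I 𝔪 x) ⊎ (∀ x → J x)
    isMaximal J J-ideal 𝔪⊆J with decide (Σ (Fin size) λ a → J (enum a) × ¬ I 𝔪 (enum a))
    ... | no  J⊆𝔪 = inj₁ λ x x∈J → let (a , a≈) = onto x in
      case decide (I 𝔪 (enum a)) of λ
        { (yes a∈𝔪) → IsIdeal.resp (isIdeal 𝔪) a≈ a∈𝔪
        ; (no  a∉𝔪) → ⊥-elim (J⊆𝔪 (a , IsIdeal.resp J-ideal (sym a≈) x∈J , a∉𝔪)) }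
    ... | yes (a , a∈J , a∉𝔪) with decide (adjoin (I 𝔪) (enum a) 1#)
    ...   | no  1∉ = ⊥-elim (a∉𝔪 (∈-saturate enum 𝔞 a 1∉))
    ...   | yes (b , d , b∈𝔪 , 1≈) = inj₂ λ x → IsIdeal.resp J-ideal (*-identityʳ x) (IsIdeal.*-cl J-ideal x 1∈J)
      where
      1∈J = IsIdeal.resp J-ideal (sym 1≈) (IsIdeal.+-cl J-ideal (𝔪⊆J _ b∈𝔪) (IsIdeal.*-cl J-ideal (enum d) a∈J))

  IsUnit : Carrier → Set ℓ
  IsUnit x = ∃ λ (j : Fin size) → x * enum j ≈ 1#

  zeroIdeal : Pred Carrier ℓ
  zeroIdeal y = y ≈ 0#

  zeroIdeal-isIdeal : IsIdeal R zeroIdeal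
  zeroIdeal-isIdeal = record
    { resp  = λ x≈y x≈0 → trans (sym x≈y) x≈0
    ; zero∈ = refl
    ; +-cl  = λ x≈0 y≈0 → trans (+-cong x≈0 y≈0) (+-identityˡ 0#)
    ; *-cl  = λ r x≈0 → trans (*-congˡ x≈0) (zeroʳ r)
    }

  nonunit∈M : ∀ x → ¬ IsUnit x → M x
  nonunit∈M x ¬unit = proj₁ (unique _ (saturate-isMaximal Rx) x) (⊆-saturate enum Rx x (∈-adjoin x zeroIdeal-isIdeal))
    where
    Rx : ProperIdeal
    Rx = record
      { I       = adjoin zeroIdeal x
      ; isIdeal = adjoin-isIdeal x zeroIdeal-isIdeal
      ; 1∉I     = λ (b , d , b≈0 , 1≈) →
          ¬unit (d , trans (*-comm x (enum d)) (sym (trans 1≈ (trans (+-congʳ b≈0) (+-identityˡ _)))))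
      }

  ∉M⇒unit : ∀ x → ¬ M x → IsUnit x
  ∉M⇒unit x x∉M with decide (IsUnit x)
  ... | yes unit = unit
  ... | no ¬unit = ⊥-elim (x∉M (nonunit∈M x ¬unit))

  neg∈M : ∀ {x} → M x → M (- x)
  neg∈M {x} x∈M = MI.resp (-1*x≈-x x) (MI.*-cl (- 1#) x∈M)

  sub∈M : ∀ {x y} → M x → M y → M (x - y)
  sub∈M x∈M y∈M = MI.+-cl x∈M (neg∈M y∈M)

  ≡1-mod-M⇒unit : ∀ {x} → M (x - 1#) → IsUnit x
  ≡1-mod-M⇒unit {x} x-1∈M = ∉M⇒unit x λ x∈M →
    proper (MI.resp (x-[x-y]≈y x 1#) (sub∈M x∈M x-1∈M))

  1-M-isUnit : ∀ {m} → M m → IsUnit (1# - m)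
  1-M-isUnit {m} m∈M = ∉M⇒unit (1# - m) λ 1-m∈M → proper (MI.resp (x-y+y≈x 1# m) (MI.+-cl 1-m∈M m∈M))

  infix 4 _≈ᴹ_
  _≈ᴹ_ : Carrier → Carrier → Set ℓ
  x ≈ᴹ y = M (x - y)

  ≈⇒≈ᴹ : ∀ {x y} → x ≈ y → x ≈ᴹ y
  ≈⇒≈ᴹ {x} {y} x≈y = MI.resp (sym (trans (+-congʳ x≈y) (-‿inverseʳ y))) MI.zero∈

  -- Its raw ring is `residue R M` on the nose, so the linear algebra over R/M applies to Defs' notions.
  residueRing : CommutativeRing c ℓ
  residueRing = record
    { Carrier = Carrier
    ; _≈_ = _≈ᴹ_
    ; _+_ = _+_
    ; _*_ = _*_
    ; -_ = -_
    ; 0# = 0#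
    ; 1# = 1#
    ; isCommutativeRing = record
      { isRing = record
        { +-isAbelianGroup = record
          { isGroup = record
            { isMonoid = record
              { isSemigroup = record
                { isMagma = record
                  { isEquivalence = record { refl = ≈⇒≈ᴹ refl ; sym = ≈ᴹ-sym ; trans = ≈ᴹ-trans }
                  ; ∙-cong = ≈ᴹ-+ }
                ; assoc = λ x y z → ≈⇒≈ᴹ (+-assoc x y z) }
              ; identity = (λ x → ≈⇒≈ᴹ (+-identityˡ x)) , (λ x → ≈⇒≈ᴹ (+-identityʳ x)) }
            ; inverse = (λ x → ≈⇒≈ᴹ (-‿inverseˡ x)) , (λ x → ≈⇒≈ᴹ (-‿inverseʳ x))
            ; ⁻¹-cong = ≈ᴹ-neg }
          ; comm = λ x y → ≈⇒≈ᴹ (+-comm x y) }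
        ; *-cong = ≈ᴹ-*
        ; *-assoc = λ x y z → ≈⇒≈ᴹ (*-assoc x y z)
        ; *-identity = (λ x → ≈⇒≈ᴹ (*-identityˡ x)) , (λ x → ≈⇒≈ᴹ (*-identityʳ x))
        ; distrib = (λ x y z → ≈⇒≈ᴹ (distribˡ x y z)) , (λ x y z → ≈⇒≈ᴹ (distribʳ x y z)) }
      ; *-comm = λ x y → ≈⇒≈ᴹ (*-comm x y) }
    }
    where
    ≈ᴹ-sym : ∀ {x y} → x ≈ᴹ y → y ≈ᴹ x
    ≈ᴹ-sym {x} {y} x≈y = MI.resp (⁻¹-anti-homo‿- x y) (neg∈M x≈y)
    ≈ᴹ-trans : ∀ {x y z} → x ≈ᴹ y → y ≈ᴹ z → x ≈ᴹ z
    ≈ᴹ-trans {x} {y} {z} x≈y y≈z = MI.resp (x-y+[y-z]≈x-z x y z) (MI.+-cl x≈y y≈z)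
    ≈ᴹ-+ : ∀ {x y u v} → x ≈ᴹ y → u ≈ᴹ v → (x + u) ≈ᴹ (y + v)
    ≈ᴹ-+ {x} {y} {u} {v} x≈y u≈v = MI.resp eq (MI.+-cl x≈y u≈v)
      where
      eq : (x - y) + (u - v) ≈ (x + u) - (y + v)
      eq = trans (solve 4 (λ x u -y -v → (x :+ -y) :+ (u :+ -v) := (x :+ u) :+ (-y :+ -v)) refl x u (- y) (- v))
                 (+-congˡ (sym (-‿+ y v)))
    ≈ᴹ-* : ∀ {x y u v} → x ≈ᴹ y → u ≈ᴹ v → (x * u) ≈ᴹ (y * v)
    ≈ᴹ-* {x} {y} {u} {v} x≈y u≈v = MI.resp eq (MI.+-cl (MI.resp (*-comm u (x - y)) (MI.*-cl u x≈y)) (MI.*-cl y u≈v))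
      where
      eq : (x - y) * u + y * (u - v) ≈ x * u - y * v
      eq = trans (+-cong ([y-z]x≈yx-zx u x y) (x[y-z]≈xy-xz y u v)) (x-y+[y-z]≈x-z (x * u) (y * u) (y * v))
    ≈ᴹ-neg : ∀ {x y} → x ≈ᴹ y → (- x) ≈ᴹ (- y)
    ≈ᴹ-neg {x} {y} x≈y = MI.resp (-‿+ x (- y)) (neg∈M x≈y)

  private
    module Res = CommutativeRing residueRing
    module ResLA = LinearAlgebra residueRing

  ∑-residue : ∀ {m} (f : Fin m → Carrier) → ∑ (residue R M) f ≡ ∑ₛ f
  ∑-residue {zero}  f = ≡.refl
  ∑-residue {suc m} f = ≡.cong (f zero +_) (∑-residue (λ t → f (suc t)))

  δ-residue : ∀ {m} (s t : Fin m) → δ (residue R M) s t ≡ δₛ s t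
  δ-residue zero    zero    = ≡.refl
  δ-residue zero    (suc t) = ≡.refl
  δ-residue (suc s) zero    = ≡.refl
  δ-residue (suc s) (suc t) = δ-residue s t

  point⇒residuePoint : ∀ {n} {α : Vect rawRing n} → IsPoint rawRing α → IsPoint (residue R M) α
  point⇒residuePoint {α = α} (B , αB≈δ) = B , λ s t →
    ≡.subst₂ _≈ᴹ_ (≡.sym (∑-residue (λ j → α j * B j t))) (≡.sym (δ-residue s t)) (≈⇒≈ᴹ (αB≈δ s t))

  spansAll⇒residue : ∀ {k n} {W : Fin k → Vect rawRing n} → SpansAll rawRing W → SpansAll (residue R M) W
  spansAll⇒residue {W = W} W-spans w = let (cs , w≋) = W-spans w in
    cs , λ j → ≡.subst (w j ≈ᴹ_) (≡.sym (∑-residue (λ t → cs t * W t j))) (≈⇒≈ᴹ (w≋ j))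

  samePoint⇒residue : ∀ {n} {α β : Vect rawRing n} → SamePoint rawRing α β → SamePoint (residue R M) α β
  samePoint⇒residue α~β =
    let (a , α≋) = samePoint⇒multiple α~β ; (b , β≋) = samePoint⇒multiple (samePoint-sym {S = rawRing} α~β) in
    ResLA.multiples⇒samePoint (a , λ j → ≈⇒≈ᴹ (α≋ j)) (b , λ j → ≈⇒≈ᴹ (β≋ j))

  residuePoint⇒point : ∀ {n} {α : Vect rawRing n} → IsPoint (residue R M) α → IsPoint rawRing α
  residuePoint⇒point {α = α} (B , αB≈δ) = (λ j _ → B j zero * w) , λ { zero zero → αB′≈1 }
    where
    x = ∑ₛ (λ j → α j * B j zero)
    x-unit = ≡1-mod-M⇒unit (≡.subst (_≈ᴹ 1#) (∑-residue (λ j → α j * B j zero)) (αB≈δ zero zero))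
    w = enum (proj₁ x-unit)
    αB′≈1 : ∑ₛ (λ j → α j * (B j zero * w)) ≈ 1#
    αB′≈1 = begin
      ∑ₛ (λ j → α j * (B j zero * w)) ≈⟨ ∑-cong (λ j → trans (sym (*-assoc (α j) (B j zero) w)) (*-comm _ w)) ⟩
      ∑ₛ (λ j → w * (α j * B j zero)) ≈⟨ ∑-*ˡ w (λ j → α j * B j zero) ⟩
      w * x                           ≈⟨ *-comm w x ⟩
      x * w                           ≈⟨ proj₂ x-unit ⟩
      1# ∎

  -- Gaussian elimination on the congruences g_j ≡ Σ_l m_jl g_l (mod N): the pivot 1 - m₀₀ is a unit.
  nakayama-elimination : ∀ {n p} {N : Vect rawRing n → Set p} → IsSubmodule N →
    ∀ q (g : Fin q → Vect rawRing n) (m : Fin q → Fin q → Carrier) → (∀ j l → M (m j l)) →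
    (∀ j → N (λ i → g j i - lincomb rawRing (m j) g i)) → ∀ j → N (g j)
  nakayama-elimination {N = N} N-sub (suc q) g m m∈M row∈N = g∈N
    where
    open IsSubmodule N-sub
    pivot-unit = 1-M-isUnit (m∈M zero zero)
    w = enum (proj₁ pivot-unit)
    g′ : Fin q → Vect rawRing _
    g′ t = g (suc t)
    a : Fin q → Carrier
    a l = w * m zero (suc l)
    rest : Fin (suc q) → Vect rawRing _
    rest j = lincomb rawRing (λ l → m j (suc l)) g′
    g₀-reduced : N (λ i → g zero i - lincomb rawRing a g′ i)
    g₀-reduced = resp eq (*-cl w (row∈N zero))
      where
      eq : ∀ i → w * (g zero i - (m zero zero * g zero i + rest zero i)) ≈ g zero i - lincomb rawRing a g′ i
      eq i = let x = g zero i ; c = m zero zero ; L = rest zero i in begin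
        w * (x - (c * x + L))      ≈⟨ *-congˡ (+-congˡ (-‿+ (c * x) L)) ⟩
        w * (x + (- (c * x) - L))  ≈⟨ *-congˡ (solve 3 (λ x -cx -L → x :+ (-cx :+ -L) := (x :+ -cx) :+ -L) refl x (- (c * x)) (- L)) ⟩
        w * ((x - c * x) - L)      ≈⟨ *-congˡ (+-congʳ (trans (+-congʳ (sym (*-identityˡ x))) (sym ([y-z]x≈yx-zx x 1# c)))) ⟩
        w * ((1# - c) * x - L)     ≈⟨ x[y-z]≈xy-xz w _ _ ⟩
        w * ((1# - c) * x) - w * L ≈⟨ +-cong (trans (sym (*-assoc w _ x)) (trans (*-congʳ (trans (*-comm w _) (proj₂ pivot-unit))) (*-identityˡ x)))
                                            (-‿cong (sym (trans (∑-cong (λ t → *-assoc w (m zero (suc t)) (g′ t i))) (∑-*ˡ w (λ t → m zero (suc t) * g′ t i))))) ⟩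
        x - lincomb rawRing a g′ i ∎
    m′ : Fin q → Fin q → Carrier
    m′ j l = m (suc j) (suc l) + m (suc j) zero * a l
    m′∈M : ∀ j l → M (m′ j l)
    m′∈M j l = MI.+-cl (m∈M (suc j) (suc l)) (MI.resp (*-comm (a l) _) (MI.*-cl (a l) (m∈M (suc j) zero)))
    row′∈N : ∀ j → N (λ i → g′ j i - lincomb rawRing (m′ j) g′ i)
    row′∈N j = resp eq (+-cl (row∈N (suc j)) (*-cl b g₀-reduced))
      where
      b = m (suc j) zero
      lincomb-m′ : ∀ i → lincomb rawRing (m′ j) g′ i ≈ rest (suc j) i + b * lincomb rawRing a g′ i
      lincomb-m′ i = begin
        ∑ₛ (λ t → (m (suc j) (suc t) + b * a t) * g′ t i)
          ≈⟨ ∑-cong (λ t → distribʳ (g′ t i) _ _) ⟩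
        ∑ₛ (λ t → m (suc j) (suc t) * g′ t i + b * a t * g′ t i)
          ≈⟨ ∑-+ _ (λ t → b * a t * g′ t i) ⟩
        rest (suc j) i + ∑ₛ (λ t → b * a t * g′ t i)
          ≈⟨ +-congˡ (trans (∑-cong (λ t → *-assoc b (a t) (g′ t i))) (∑-*ˡ b (λ t → a t * g′ t i))) ⟩
        rest (suc j) i + b * lincomb rawRing a g′ i ∎
      eq : ∀ i → (g′ j i - (b * g zero i + rest (suc j) i)) + b * (g zero i - lincomb rawRing a g′ i)
                 ≈ g′ j i - lincomb rawRing (m′ j) g′ i
      eq i = begin
        (x - (b * y + L)) + b * (y - A)
          ≈⟨ +-cong (+-congˡ (-‿+ (b * y) L)) (x[y-z]≈xy-xz b y A) ⟩
        (x + (- (b * y) + - L)) + (b * y - b * A)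
          ≈⟨ solve 5 (λ x p q s r → (x :+ (p :+ q)) :+ (s :+ r) := (x :+ (q :+ r)) :+ (p :+ s)) refl x (- (b * y)) (- L) (b * y) (- (b * A)) ⟩
        (x + (- L - b * A)) + (- (b * y) + b * y)
          ≈⟨ trans (+-congˡ (-‿inverseˡ (b * y))) (+-identityʳ _) ⟩
        x + (- L - b * A)
          ≈⟨ +-congˡ (sym (-‿+ L (b * A))) ⟩
        x - (L + b * A)
            ≈⟨ +-congˡ (-‿cong (sym (lincomb-m′ i))) ⟩
        x - lincomb rawRing (m′ j) g′ i ∎
        where
        x = g′ j i
        y = g zero i
        L = rest (suc j) i
        A = lincomb rawRing a g′ i
    g′∈N = nakayama-elimination N-sub q g′ m′ m′∈M row′∈N
    g∈N : ∀ j → N (g j)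
    g∈N zero    = resp (λ i → x-y+y≈x (g zero i) _) (+-cl g₀-reduced (lincomb∈ N-sub a g′ g′∈N))
    g∈N (suc j) = g′∈N j

  nakayama : ∀ {k n} (W : Fin k → Vect rawRing n) → SpansAll (residue R M) W → SpansAll rawRing W
  nakayama {k} {n} W W-spans w = IsSubmodule.resp span (λ i → ∑-δʳ i w) (lincomb∈ span w ε ε∈span)
    where
    span = span-isSubmodule W
    ε : Fin n → Vect rawRing n
    ε j i = δₛ j i
    cs : Fin n → Fin k → Carrier
    cs j = proj₁ (W-spans (ε j))
    m : Fin n → Fin n → Carrier
    m j l = δₛ j l - lincomb (residue R M) (cs j) W l
    ε∈span : ∀ j → InSpan rawRing W (ε j)
    ε∈span = nakayama-elimination span n ε m (λ j → proj₂ (W-spans (ε j))) λ j →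
      cs j , λ i → trans (+-congˡ (-‿cong (∑-δʳ i (m j))))
                   (trans (x-[x-y]≈y (δₛ j i) _) (reflexive (∑-residue (λ t → cs j t * W t i))))


  private
    1≉0 : ¬ 1# ≈ 0#
    1≉0 1≈0 = proper (MI.resp (sym 1≈0) MI.zero∈)

  open FiniteRing R fin 1≉0 using (¬spansAll-fewer)

  -- If ⟨P t⟩ = ⟨P u⟩ mod M for t ≠ u, then n of the points lie in the span of n - 1 vectors,
  -- which by Nakayama would span R^n.
  residue-distinct : ∀ {n k} (P : Fin k → Vect rawRing n) → 2 ≤ n → suc n ≤ k → EveryNSpan (residue R M) n k P →
                     ∀ t u → SamePoint (residue R M) (P t) (P u) → t ≡ u
  residue-distinct {suc (suc n)} P (s≤s (s≤s z≤n)) n<k P-spans t u t~u with t ≟ᶠ u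
  ... | yes t≡u = t≡u
  ... | no  t≢u = ⊥-elim (¬spansAll-fewer ≤-refl G (nakayama G G-spans))
    where
    injection = injection-through (≤-trans (n≤1+n _) n<k) t u t≢u
    f = proj₁ injection
    G : Fin (suc n) → Vect rawRing (suc (suc n))
    G = P t ∷ (λ j → P (f (suc (suc j))))
    Pf∈span : ∀ a → InSpan (residue R M) G (P (f a))
    Pf∈span zero          = ≡.subst (λ x → InSpan (residue R M) G (P x)) (≡.sym (proj₁ (proj₂ (proj₂ injection))))
                              (ResLA.generator∈span G zero)
    Pf∈span (suc zero)    = ≡.subst (λ x → InSpan (residue R M) G (P x)) (≡.sym (proj₂ (proj₂ (proj₂ injection))))
                              (ResLA.multiple∈span G zero (ResLA.samePoint⇒multiple (samePoint-sym {S = residue R M} t~u)))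
    Pf∈span (suc (suc j)) = ResLA.generator∈span G (suc j)
    G-spans = ResLA.spansAll-by-spanning G (λ a → P (f a)) (P-spans f (proj₁ (proj₂ injection))) Pf∈span

  residueArc : ∀ {n k} {P : Fin k → Vect rawRing n} → 2 ≤ n → suc n ≤ k →
               (∀ t → IsPoint rawRing (P t)) → EveryNSpan rawRing n k P → IsArc (residue R M) n k P
  residueArc {P = P} 2≤n n<k points spanning = record
    { points   = λ t → point⇒residuePoint (points t)
    ; distinct = residue-distinct P 2≤n n<k residue-spanning
    ; size     = n<k
    ; spanning = residue-spanning
    }
    where
    residue-spanning : EveryNSpan (residue R M) _ _ P
    residue-spanning f f-injective = spansAll⇒residue (spanning f f-injective)

  residueArc⇒arc : ∀ {n k} {P : Fin k → Vect rawRing n} → IsArc (residue R M) n k P → IsArc rawRing n k P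
  residueArc⇒arc arc = record
    { points   = λ t → residuePoint⇒point (IsArc.points arc t)
    ; distinct = λ t u t~u → IsArc.distinct arc t u (samePoint⇒residue t~u)
    ; size     = IsArc.size arc
    ; spanning = λ f f-injective → nakayama _ (IsArc.spanning arc f f-injective)
    }

  private
    index : Carrier → Fin size
    index x = proj₁ (onto x)

    index≈ : ∀ x → enum (index x) ≈ x
    index≈ x = proj₂ (onto x)

  -- Level-ℓ renderings of the residue notions (scalars range over the enumeration), so that
  -- `decide` applies to them.
  IsPointᴹ : ∀ {n} → Vect rawRing n → Set ℓ
  IsPointᴹ {n} v = Σ (Fin n → Fin size) λ B → ∑ₛ (λ j → v j * enum (B j)) ≈ᴹ 1#

  SamePointᴹ : ∀ {n} → Vect rawRing n → Vect rawRing n → Set ℓ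
  SamePointᴹ α β = Σ (Fin size) λ a → Σ (Fin size) λ b → (∀ j → α j ≈ᴹ enum a * β j) × (∀ j → β j ≈ᴹ enum b * α j)

  EveryNSpanᴹ : ∀ n k → (Fin k → Vect rawRing n) → Set ℓ
  EveryNSpanᴹ n k P = (f : Fin n → Fin k) → InjectiveFin f → (w : Fin n → Fin size) →
    Σ (Fin n → Fin size) λ cs → ∀ j → enum (w j) ≈ᴹ ∑ₛ (λ a → enum (cs a) * P (f a) j)

  pointᴹ⇒point : ∀ {n} {v : Vect rawRing n} → IsPointᴹ v → IsPoint (residue R M) v
  pointᴹ⇒point {v = v} (B , vB≈1) = (λ j _ → enum (B j)) ,
    λ { zero zero → ≡.subst (_≈ᴹ 1#) (≡.sym (∑-residue (λ j → v j * enum (B j)))) vB≈1 }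

  point⇒pointᴹ : ∀ {n} {v α : Vect rawRing n} → (∀ j → v j ≈ α j) → IsPoint (residue R M) α → IsPointᴹ v
  point⇒pointᴹ {v = v} {α} v≈α (B , αB≈δ) = (λ j → index (B j zero)) ,
    Res.trans (≈⇒≈ᴹ (∑-cong (λ j → *-cong (v≈α j) (index≈ (B j zero)))))
              (≡.subst (_≈ᴹ 1#) (∑-residue (λ j → α j * B j zero)) (αB≈δ zero zero))

  samePointᴹ⇒samePoint : ∀ {n} {α β : Vect rawRing n} → SamePointᴹ α β → SamePoint (residue R M) α β
  samePointᴹ⇒samePoint (a , b , α≈ , β≈) = ResLA.multiples⇒samePoint (enum a , α≈) (enum b , β≈)

  samePoint⇒samePointᴹ : ∀ {n} {α β : Vect rawRing n} → SamePoint (residue R M) α β → SamePointᴹ α β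
  samePoint⇒samePointᴹ {α = α} {β} α~β = multiple (ResLA.samePoint⇒multiple α~β) (ResLA.samePoint⇒multiple (samePoint-sym {S = residue R M} α~β))
    where
    multiple : ResLA.IsMultipleOf β α → ResLA.IsMultipleOf α β → SamePointᴹ α β
    multiple (a , α≈) (b , β≈) = index a , index b ,
      (λ j → Res.trans (α≈ j) (≈⇒≈ᴹ (*-congʳ (sym (index≈ a))))) ,
      (λ j → Res.trans (β≈ j) (≈⇒≈ᴹ (*-congʳ (sym (index≈ b)))))

  everyNSpanᴹ⇒everyNSpan : ∀ {n k} {P : Fin k → Vect rawRing n} → EveryNSpanᴹ n k P → EveryNSpan (residue R M) n k P
  everyNSpanᴹ⇒everyNSpan {P = P} P-spans f f-injective w = lift (P-spans f f-injective (λ j → index (w j)))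
    where
    lift : (Σ (Fin _ → Fin size) λ cs → ∀ j → enum (index (w j)) ≈ᴹ ∑ₛ (λ a → enum (cs a) * P (f a) j)) →
           InSpan (residue R M) (λ a → P (f a)) w
    lift (cs , w≈) = (λ a → enum (cs a)) , λ j →
      Res.trans (≈⇒≈ᴹ (sym (index≈ (w j))))
                (≡.subst (enum (index (w j)) ≈ᴹ_) (≡.sym (∑-residue (λ a → enum (cs a) * P (f a) j))) (w≈ j))

  everyNSpan⇒everyNSpanᴹ : ∀ {n k} {P : Fin k → Vect rawRing n} → EveryNSpan (residue R M) n k P → EveryNSpanᴹ n k P
  everyNSpan⇒everyNSpanᴹ {P = P} P-spans f f-injective w = lower (P-spans f f-injective (λ j → enum (w j)))
    where
    lower : InSpan (residue R M) (λ a → P (f a)) (λ j → enum (w j)) →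
            Σ (Fin _ → Fin size) λ cs → ∀ j → enum (w j) ≈ᴹ ∑ₛ (λ a → enum (cs a) * P (f a) j)
    lower (cs , w≈) = (λ a → index (cs a)) , λ j →
      Res.trans (≡.subst (enum (w j) ≈ᴹ_) (∑-residue (λ a → cs a * P (f a) j)) (w≈ j))
                (≈⇒≈ᴹ (∑-cong (λ a → *-congʳ (sym (index≈ (cs a))))))

  Extends : ∀ {n k} → (Fin k → Vect rawRing n) → Vect rawRing n → Set ℓ
  Extends {n} {k} A v = IsPointᴹ v × (∀ t → ¬ SamePointᴹ v (A t)) × EveryNSpanᴹ n (suc k) (v ∷ A)

  extension-isArc : ∀ {n k} {A : Fin k → Vect rawRing n} {v} →
                    IsArc (residue R M) n k A → Extends A v → IsArc (residue R M) n (suc k) (v ∷ A)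
  extension-isArc {A = A} {v} arc (v-point , v-new , spans) = record
    { points   = λ { zero → pointᴹ⇒point v-point ; (suc t) → IsArc.points arc t }
    ; distinct = distinct
    ; size     = m≤n⇒m≤1+n (IsArc.size arc)
    ; spanning = everyNSpanᴹ⇒everyNSpan {P = v ∷ A} spans
    }
    where
    distinct : ∀ x y → SamePoint (residue R M) _ _ → x ≡ y
    distinct zero    zero    _   = ≡.refl
    distinct zero    (suc u) v~u = ⊥-elim (v-new u (samePoint⇒samePointᴹ v~u))
    distinct (suc t) zero    t~v = ⊥-elim (v-new t (samePoint⇒samePointᴹ (samePoint-sym {S = residue R M} t~v)))
    distinct (suc t) (suc u) t~u = ≡.cong suc (IsArc.distinct arc t u t~u)

  -- A point ⟨Q u⟩ of a larger arc that is none of the ⟨A t⟩ would, through a representative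
  -- from the enumeration, extend A.
  no-extension⇒complete : ∀ {n k} {A : Fin k → Vect rawRing n} → IsArc (residue R M) n k A →
                          ¬ (Σ (Fin n → Fin size) λ p → Extends A (λ j → enum (p j))) →
                          IsComplete (residue R M) n k A
  no-extension⇒complete {n} {k} {A} arc no-extension k′ Q Q-arc A⊆Q u =
    decided (decide (Σ (Fin k) λ t → SamePointᴹ v (A t)))
    where
    p : Fin n → Fin size
    p j = index (Q u j)
    v : Vect rawRing n
    v j = enum (p j)
    Qu~v : SamePoint (residue R M) (Q u) v
    Qu~v = ResLA.≋⇒samePoint (λ j → ≈⇒≈ᴹ (sym (index≈ (Q u j))))
    g : Fin k → Fin k′
    g t = proj₁ (A⊆Q t)
    At~Q : ∀ t {x} → g t ≡ x → SamePoint (residue R M) (A t) (Q x)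
    At~Q t g≡x = ≡.subst (λ x → SamePoint (residue R M) (A t) (Q x)) g≡x (proj₂ (A⊆Q t))
    decided : Dec (Σ (Fin k) λ t → SamePointᴹ v (A t)) → ∃ λ t → SamePoint (residue R M) (Q u) (A t)
    decided (yes (t , v~At)) = t , samePoint-trans {S = residue R M} Qu~v (samePointᴹ⇒samePoint v~At)
    decided (no v∉A) = ⊥-elim (no-extension (p , point⇒pointᴹ (λ j → index≈ (Q u j)) (IsArc.points Q-arc u) ,
                                                   (λ t v~At → v∉A (t , v~At)) , spans))
      where
      h : Fin (suc k) → Fin k′
      h = u ∷ g
      v~At : ∀ t → u ≡ g t → SamePointᴹ v (A t)
      v~At t u≡gt = samePoint⇒samePointᴹ
        (samePoint-trans {S = residue R M} (samePoint-sym {S = residue R M} Qu~v) (samePoint-sym {S = residue R M} (At~Q t (≡.sym u≡gt))))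
      h-injective : InjectiveFin h
      h-injective zero    zero     _     = ≡.refl
      h-injective zero    (suc t)  u≡gt  = ⊥-elim (v∉A (t , v~At t u≡gt))
      h-injective (suc t) zero     gt≡u  = ⊥-elim (v∉A (t , v~At t (≡.sym gt≡u)))
      h-injective (suc t) (suc t′) gt≡gt′ = ≡.cong suc (IsArc.distinct arc t t′
        (samePoint-trans {S = residue R M} (At~Q t gt≡gt′) (samePoint-sym {S = residue R M} (At~Q t′ ≡.refl))))
      Qh~vA : ∀ x → SamePoint (residue R M) (Q (h x)) ((v ∷ A) x)
      Qh~vA zero    = Qu~v
      Qh~vA (suc t) = samePoint-sym {S = residue R M} (proj₂ (A⊆Q t))
      spans : EveryNSpanᴹ n (suc k) (v ∷ A)
      spans = everyNSpan⇒everyNSpanᴹ {P = v ∷ A} λ f f-injective →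
        ResLA.spansAll-by-spanning (λ a → (v ∷ A) (f a)) (λ a → Q (h (f a)))
          (IsArc.spanning Q-arc (λ a → h (f a)) (λ a b eq → f-injective a b (h-injective (f a) (f b) eq)))
          (λ a → ResLA.multiple∈span (λ a → (v ∷ A) (f a)) a (ResLA.samePoint⇒multiple (Qh~vA (f a))))

  complete-or-extension : ∀ {n k} {A : Fin k → Vect rawRing n} → IsArc (residue R M) n k A →
                          IsComplete (residue R M) n k A ⊎ ∃ λ v → IsArc (residue R M) n (suc k) (v ∷ A)
  complete-or-extension {n} {k} {A} arc with decide (Σ (Fin n → Fin size) λ p → Extends A (λ j → enum (p j)))
  ... | yes (p , extends) = inj₂ (_ , extension-isArc arc extends)
  ... | no  no-extension  = inj₁ (no-extension⇒complete arc no-extension)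

module ProductRing {c ℓ : Level} {L : ℕ} (Rs : Fin L → CommutativeRing c ℓ) where
  open CommutativeRing using (Carrier; rawRing)
  private
    ℛ = productRing Rs
    ℛ-Carrier = RawRing.Carrier ℛ
    module Rᵢ (i : Fin L) = CommutativeRing (Rs i)

  glue : ∀ {n k} → ((i : Fin L) → Fin k → Vect (rawRing (Rs i)) n) → Fin k → Vect ℛ n
  glue B t j i = B i t j

  ∑-ρ : ∀ {m} (f : Fin m → ℛ-Carrier) i → ∑ ℛ f i ≡ ∑ (rawRing (Rs i)) (λ t → f t i)
  ∑-ρ {zero}  f i = ≡.refl
  ∑-ρ {suc m} f i = ≡.cong (Rᵢ._+_ i (f zero i)) (∑-ρ (λ t → f (suc t)) i)

  δ-ρ : ∀ {m} (s t : Fin m) i → δ ℛ s t i ≡ δ (rawRing (Rs i)) s t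
  δ-ρ zero    zero    i = ≡.refl
  δ-ρ zero    (suc t) i = ≡.refl
  δ-ρ (suc s) zero    i = ≡.refl
  δ-ρ (suc s) (suc t) i = δ-ρ s t i

  point-ρ : ∀ {n} {α : Vect ℛ n} → IsPoint ℛ α → ∀ i → IsPoint (rawRing (Rs i)) (ρ Rs i α)
  point-ρ {α = α} (B , αB≈δ) i = (λ j t → B j t i) , λ s t →
    ≡.subst₂ (Rᵢ._≈_ i) (∑-ρ (λ j i′ → Rᵢ._*_ i′ (α j i′) (B j t i′)) i) (δ-ρ s t i) (αB≈δ s t i)

  point-glue : ∀ {n} {α : Vect ℛ n} → (∀ i → IsPoint (rawRing (Rs i)) (ρ Rs i α)) → IsPoint ℛ α
  point-glue {α = α} points = (λ j t i → proj₁ (points i) j t) , λ s t i →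
    ≡.subst₂ (Rᵢ._≈_ i) (≡.sym (∑-ρ (λ j i′ → Rᵢ._*_ i′ (α j i′) (proj₁ (points i′) j t)) i)) (≡.sym (δ-ρ s t i))
             (proj₂ (points i) s t)

  spansAll-ρ : ∀ {k n} {W : Fin k → Vect ℛ n} → SpansAll ℛ W → ∀ i → SpansAll (rawRing (Rs i)) (λ a → ρ Rs i (W a))
  spansAll-ρ {W = W} W-spans i w = project (W-spans lift)
    where
    lift : Vect ℛ _
    lift j i′ with i ≟ᶠ i′
    ... | yes ≡.refl = w j
    ... | no  _      = Rᵢ.0# i′
    lift-at : ∀ j → lift j i ≡ w j
    lift-at j with i ≟ᶠ i
    ... | yes ≡.refl = ≡.refl
    ... | no  i≢i    = ⊥-elim (i≢i ≡.refl)
    project : InSpan ℛ W lift → InSpan (rawRing (Rs i)) (λ a → ρ Rs i (W a)) w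
    project (cs , lift≈) = (λ t → cs t i) , λ j →
      ≡.subst₂ (Rᵢ._≈_ i) (lift-at j) (∑-ρ (λ t i′ → Rᵢ._*_ i′ (cs t i′) (W t j i′)) i) (lift≈ j i)

  spansAll-glue : ∀ {k n} {W : Fin k → Vect ℛ n} → (∀ i → SpansAll (rawRing (Rs i)) (λ a → ρ Rs i (W a))) → SpansAll ℛ W
  spansAll-glue {W = W} spans w = cs , λ j i →
    ≡.subst (Rᵢ._≈_ i (w j i)) (≡.sym (∑-ρ (λ t i′ → Rᵢ._*_ i′ (cs t i′) (W t j i′)) i)) (proj₂ (spans i (λ j → w j i)) j)
    where
    cs : Fin _ → ℛ-Carrier
    cs t i = proj₁ (spans i (λ j → w j i)) t

  samePoint-ρ : ∀ {n} {α β : Vect ℛ n} → SamePoint ℛ α β → ∀ i → SamePoint (rawRing (Rs i)) (ρ Rs i α) (ρ Rs i β)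
  samePoint-ρ α~β i = LinearAlgebra.multiples⇒samePoint (Rs i) (multiple α~β) (multiple (samePoint-sym {S = ℛ} α~β))
    where
    multiple : ∀ {α β} → SamePoint ℛ α β → LinearAlgebra.IsMultipleOf (Rs i) (ρ Rs i β) (ρ Rs i α)
    multiple {α} α~β = from-span (proj₁ (α~β α) ((λ _ i′ → Rᵢ.1# i′) , λ j i′ →
      Rᵢ.sym i′ (Rᵢ.trans i′ (Rᵢ.+-identityʳ i′ _) (Rᵢ.*-identityˡ i′ _))))
      where
      from-span : ∀ {β} → InSpan ℛ (single ℛ β) α → LinearAlgebra.IsMultipleOf (Rs i) (ρ Rs i β) (ρ Rs i α)
      from-span (cs , α≈) = cs zero i , λ j → Rᵢ.trans i (α≈ j i) (Rᵢ.+-identityʳ i _)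

  arc-glue : ∀ {n k} (B : (i : Fin L) → Fin k → Vect (rawRing (Rs i)) n) →
             (∀ i → IsArc (rawRing (Rs i)) n k (B i)) → Fin L → IsArc ℛ n k (glue B)
  arc-glue B arcs i₀ = record
    { points   = λ t → point-glue (λ i → IsArc.points (arcs i) t)
    ; distinct = λ t u t~u → IsArc.distinct (arcs i₀) t u (samePoint-ρ t~u i₀)
    ; size     = IsArc.size (arcs i₀)
    ; spanning = λ f f-injective → spansAll-glue (λ i → IsArc.spanning (arcs i) f f-injective)
    }

module ProductOfLocalRings {c ℓ : Level} {L : ℕ} (Rs : Fin L → CommutativeRing c ℓ)
  (Ms : (i : Fin L) → Pred (CommutativeRing.Carrier (Rs i)) ℓ)
  (fins : ∀ i → IsFinite (Rs i)) (locs : ∀ i → IsLocalWith (Rs i) (Ms i)) {n : ℕ} (2≤n : 2 ≤ n) where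
  open ProductRing Rs
  private
    ℛ = productRing Rs
    module Loc (i : Fin L) = LocalRing (Rs i) (Ms i) (fins i) (locs i)
    𝔽 : Fin L → RawRing c ℓ
    𝔽 i = residue (Rs i) (Ms i)

  residueArc-πρ : ∀ {k} {A : Fin k → Vect ℛ n} → IsArc ℛ n k A → ∀ i → IsArc (𝔽 i) n k (λ t → πρ Rs i (Ms i) (A t))
  residueArc-πρ arc i = Loc.residueArc i 2≤n (IsArc.size arc)
    (λ t → point-ρ (IsArc.points arc t) i) (λ f f-injective → spansAll-ρ (IsArc.spanning arc f f-injective) i)

  arc-ρ : ∀ {k} {A : Fin k → Vect ℛ n} → IsArc ℛ n k A →
          ∀ i → IsArc (CommutativeRing.rawRing (Rs i)) n k (λ t → ρ Rs i (A t))
  arc-ρ arc i = Loc.residueArc⇒arc i (residueArc-πρ arc i)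

  residueComplete⇒complete : ∀ {k} {A : Fin k → Vect ℛ n} → IsArc ℛ n k A →
    (∃ λ i₀ → IsComplete (𝔽 i₀) n k (λ t → πρ Rs i₀ (Ms i₀) (A t))) → IsComplete ℛ n k A
  residueComplete⇒complete {A = A} arc (i₀ , complete) k′ Q Q-arc A⊆Q u =
    found (complete k′ (λ x → πρ Rs i₀ (Ms i₀) (Q x)) Q-arc₀ A⊆Q₀ u)
    where
    Q-arc₀ = residueArc-πρ Q-arc i₀
    A⊆Q₀ : PointsIncluded (𝔽 i₀) (λ t → πρ Rs i₀ (Ms i₀) (A t)) (λ x → πρ Rs i₀ (Ms i₀) (Q x))
    A⊆Q₀ t = proj₁ (A⊆Q t) , Loc.samePoint⇒residue i₀ (samePoint-ρ (proj₂ (A⊆Q t)) i₀)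
    found : (∃ λ t → SamePoint (𝔽 i₀) (πρ Rs i₀ (Ms i₀) (Q u)) (πρ Rs i₀ (Ms i₀) (A t))) →
            ∃ λ t → SamePoint ℛ (Q u) (A t)
    found (t , Qu~At) = t , ≡.subst (λ x → SamePoint ℛ (Q x) (A t)) (≡.sym u≡) (samePoint-sym {S = ℛ} (proj₂ (A⊆Q t)))
      where
      u≡ : u ≡ proj₁ (A⊆Q t)
      u≡ = IsArc.distinct Q-arc₀ u _ (samePoint-trans {S = 𝔽 i₀} Qu~At (proj₂ (A⊆Q₀ t)))

  -- If no residue arc were complete, each would extend by a new point; lifting these (Nakayama)
  -- and gluing them would extend A itself.
  complete⇒residueComplete : ∀ {k} {A : Fin k → Vect ℛ n} → IsArc ℛ n k A → Fin L → IsComplete ℛ n k A →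
    ∃ λ i₀ → IsComplete (𝔽 i₀) n k (λ t → πρ Rs i₀ (Ms i₀) (A t))
  complete⇒residueComplete {k} {A} arc i complete =
    [ (λ residue-complete → residue-complete) , (λ extension → ⊥-elim (extension-contradicts extension)) ]′
      (∃⊎∀ (λ i → Loc.complete-or-extension i (residueArc-πρ arc i)))
    where
    extension-contradicts : (∀ i → ∃ λ v → IsArc (𝔽 i) n (suc k) (v ∷ (λ t → πρ Rs i (Ms i) (A t)))) → ⊥
    extension-contradicts extension = new≢old (complete (suc k) (glue B) extended-arc A⊆extended zero)
      where
      B : (i : Fin L) → Fin (suc k) → Vect (CommutativeRing.rawRing (Rs i)) n
      B i = proj₁ (extension i) ∷ (λ t → ρ Rs i (A t))
      extended-arc : IsArc ℛ n (suc k) (glue B)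
      extended-arc = arc-glue B (λ i → Loc.residueArc⇒arc i (proj₂ (extension i))) i
      A⊆extended : PointsIncluded ℛ A (glue B)
      A⊆extended t = suc t , samePoint-refl {S = ℛ}
      new≢old : ¬ ∃ λ t → SamePoint ℛ (glue B zero) (A t)
      new≢old (t , new~At) = 0≢1+n (IsArc.distinct extended-arc zero (suc t) new~At)

theorem6p1 : ∀ {c ℓ} (L : ℕ) → 1 ≤ L →
    (Rs : Fin L → CommutativeRing c ℓ) →
    (Ms : (i : Fin L) → Pred (CommutativeRing.Carrier (Rs i)) ℓ) →
    (∀ i → IsFinite (Rs i)) →
    (∀ i → IsLocalWith (Rs i) (Ms i)) →
    (n : ℕ) → 2 ≤ n →
    (k : ℕ) (A : Fin k → Vect (productRing Rs) n) →
    IsArc (productRing Rs) n k A →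
    ((i : Fin L) →
        IsArc (CommutativeRing.rawRing (Rs i)) n k (λ t → ρ Rs i (A t))
      × IsArc (residue (Rs i) (Ms i)) n k (λ t → πρ Rs i (Ms i) (A t)))
    × (IsComplete (productRing Rs) n k A ⇔
        ∃ λ (i₀ : Fin L) →
          IsComplete (residue (Rs i₀) (Ms i₀)) n k (λ t → πρ Rs i₀ (Ms i₀) (A t)))
theorem6p1 L 1≤L Rs Ms fins locs n 2≤n k A arc =
  (λ i → arc-ρ arc i , residueArc-πρ arc i) ,
  mk⇔ (complete⇒residueComplete arc (fromℕ< 1≤L)) (residueComplete⇒complete arc)
  where open ProductOfLocalRings Rs Ms fins locs 2≤n
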